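{- Let $D=(d_1,\ldots,d_n)$, with $d_1\ge d_2\ge\cdots\ge d_n$, be a forcibly bicyclic graphic sequence. If $n\ge 7$, $D\neq(4,2^6)$ and $D\neq(5,2^6,1)$, then $d_7=1$.
   Context: All graphs are simple. A realization of a sequence $D=(d_1,\ldots,d_n)$ is a simple graph with vertices $v_1,\ldots,v_n$ with $\deg(v_i)=d_i$; $D$ is graphic if it has a realization. A graphic sequence is forcibly bicyclic if every realization of it is connected and has exactly $n+1$ edges. The notation $a^c$ in a sequence means $c$ consecutive entries equal to $a$. -}

module Defs where

open import Data.Nat using (ℕ; zero; suc; _+_; _≤_; _≥_)
open import Data.Bool using (Bool; true; false)
open import Data.Fin using (Fin; toℕ)
open import Data.Vec using (Vec; lookup; replicate; _∷_; []; _++_)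
open import Data.Product using (Σ; _×_; _,_)
open import Relation.Binary.PropositionalEquality using (_≡_; _≢_)
open import Relation.Nullary using (¬_)

record SimpleGraph (n : ℕ) : Set where
  field
    adj   : Fin n → Fin n → Bool
    sym   : ∀ u v → adj u v ≡ adj v u
    irrefl : ∀ v → adj v v ≡ false
open SimpleGraph public

countTrue : ∀ {n} → (Fin n → Bool) → ℕ
countTrue {zero} f = 0
countTrue {suc n} f with f Data.Fin.zero
... | true  = suc (countTrue (λ i → f (Data.Fin.suc i)))
... | false = countTrue (λ i → f (Data.Fin.suc i))

degree : ∀ {n} → SimpleGraph n → Fin n → ℕ
degree G v = countTrue (adj G v)

sumFin : ∀ {n} → (Fin n → ℕ) → ℕ
sumFin {zero} f = 0
sumFin {suc n} f = f Data.Fin.zero + sumFin (λ i → f (Data.Fin.suc i))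

numEdges : ∀ {n} → SimpleGraph n → ℕ
numEdges {n} G = sumFin (λ u → countTrue (λ v → lt u v))
  where
    lt : Fin n → Fin n → Bool
    lt u v with Data.Fin._<?_ u v
    ... | Relation.Nullary.yes _ = adj G u v
    ... | Relation.Nullary.no _  = false

data Walk {n} (G : SimpleGraph n) : Fin n → Fin n → Set where
  here : ∀ {u} → Walk G u u
  step : ∀ {u w v} → adj G u w ≡ true → Walk G w v → Walk G u v

Connected : ∀ {n} → SimpleGraph n → Set
Connected G = ∀ u v → Walk G u v

Realization : ∀ {n} → Vec ℕ n → SimpleGraph n → Set
Realization D G = ∀ i → degree G i ≡ lookup D i

Graphic : ∀ {n} → Vec ℕ n → Set
Graphic {n} D = Σ (SimpleGraph n) (Realization D)

ForciblyBicyclic : ∀ {n} → Vec ℕ n → Set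
ForciblyBicyclic {n} D =
  Graphic D × (∀ (G : SimpleGraph n) → Realization D G →
                 Connected G × numEdges G ≡ suc n)

NonIncreasing : ∀ {n} → Vec ℕ n → Set
NonIncreasing D = ∀ i j → toℕ i ≤ toℕ j → lookup D i ≥ lookup D j

-- a heterogeneous comparison of a sequence to a fixed-length list
_≡seq_ : ∀ {n m} → Vec ℕ n → Vec ℕ m → Set
_≡seq_ {n} {m} D E = Σ (n ≡ m) λ { Relation.Binary.PropositionalEquality.refl → D ≡ E }

seqA : Vec ℕ 7
seqA = 4 ∷ replicate 6 2

seqB : Vec ℕ 8
seqB = 5 ∷ (replicate 6 2 ++ (1 ∷ []))

module Submission where

-- Suppose d₇ ≥ 2, and let k ≥ 7 be the number of entries ≥ 2; the other n − k entries are 1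
-- and the degree sum is 2n + 2. We build a disconnected realization, contradicting forcible
-- bicyclicity. Start from a skeleton whose s vertices carry s + 1 edges and two components:
-- K₄ minus an edge plus a cycle through the other k − 4 large vertices when d₂ ≥ 3; the bowtie
-- plus a cycle through the other k − 5 when d₂ = 2 and k ≥ 8; three triangles at a common vertex
-- plus a disjoint edge when k = 7 and n ≥ 9. Each skeleton degree is at most its target, and the
-- degree sums force the total deficit to be exactly n − s, so the remaining vertices can be
-- attached as pendant vertices without merging the components. The cases k = 7, n ∈ {7, 8} are
-- the excluded sequences (4, 2⁶) and (5, 2⁶, 1).

open import Defs hiding (sym)
open import Function using (_∘_)
open import Data.Unit using (tt)
open import Data.Empty using (⊥; ⊥-elim)
open import Data.Product using (Σ; _×_; _,_; proj₁; proj₂)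
open import Data.Sum using (_⊎_; inj₁; inj₂)
open import Data.Bool using (Bool; true; false; _∨_; if_then_else_; T)
open import Data.Bool.Properties as Bool using (∨-comm; ∨-identityʳ; ∨-zeroʳ)
open import Data.Nat
  using (ℕ; zero; suc; _+_; _*_; _∸_; _≤_; _<_; _≥_; z≤n; s≤s; s≤s⁻¹; z<s; s<s; _≡ᵇ_; _<ᵇ_)
open import Data.Nat.Properties
open import Data.Nat.Tactic.RingSolver using (solve-∀)
open import Data.Fin as Fin using (Fin; toℕ; fromℕ<)
import Data.Fin.Properties as FinP
open import Data.Vec as Vec using (Vec; lookup; []; _∷_)
open import Data.List using (List; []; _∷_; length; _++_; replicate)
open import Data.List.Properties using (length-++; length-replicate)
open import Data.List.Relation.Unary.All as All using (All; []; _∷_)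
import Data.List.Relation.Unary.All.Properties as All
open import Data.List.Relation.Unary.AllPairs using ([]; _∷_)
open import Data.List.Relation.Unary.Unique.Propositional using (Unique)
open import Data.List.Relation.Unary.Unique.DecPropositional _≟_ using (unique?)
open import Data.List.Membership.DecPropositional _≟_ using (_∈_; _∉_; _∈?_)
open import Relation.Nullary using (¬_; Dec; does; yes; no)
open import Relation.Nullary.Decidable using (dec-true; dec-false; from-yes; _×-dec_; True; toWitness)
import Relation.Unary as U
open import Relation.Binary.Definitions using (tri<; tri≈; tri>)
open import Relation.Binary.PropositionalEquality
  using (_≡_; _≢_; refl; sym; trans; cong; cong₂; subst; subst₂; module ≡-Reasoning)
open import Algebra.Properties.CommutativeMonoid.Sum +-0-commutativeMonoid
  using (sum; sum-cong-≗; ∑-distrib-+; ∑-comm)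

⟦_⟧ : Bool → ℕ
⟦ true ⟧  = 1
⟦ false ⟧ = 0

⟦∨⟧ : ∀ {a b} → (a ≡ true → b ≡ false) → ⟦ a ∨ b ⟧ ≡ ⟦ a ⟧ + ⟦ b ⟧
⟦∨⟧ {true}  b-false rewrite b-false refl = refl
⟦∨⟧ {false} _       = refl

≡ᵇ-true⇒≡ : ∀ {m n} → (m ≡ᵇ n) ≡ true → m ≡ n
≡ᵇ-true⇒≡ {m} {n} eq = ≡ᵇ⇒≡ m n (subst T (sym eq) tt)

≡ᵇ-comm : ∀ m n → (m ≡ᵇ n) ≡ (n ≡ᵇ m)
≡ᵇ-comm zero    zero    = refl
≡ᵇ-comm zero    (suc n) = refl
≡ᵇ-comm (suc m) zero    = refl
≡ᵇ-comm (suc m) (suc n) = ≡ᵇ-comm m n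

+-≡ᵇ : ∀ k m n → (k + m ≡ᵇ k + n) ≡ (m ≡ᵇ n)
+-≡ᵇ zero    m n = refl
+-≡ᵇ (suc k) m n = +-≡ᵇ k m n

⟦<ᵇ⟧+⟦≡ᵇ⟧ : ∀ {x m} → x ≤ m → ⟦ x <ᵇ m ⟧ + ⟦ x ≡ᵇ m ⟧ ≡ 1
⟦<ᵇ⟧+⟦≡ᵇ⟧ {zero}  {zero}  _         = refl
⟦<ᵇ⟧+⟦≡ᵇ⟧ {zero}  {suc m} _         = refl
⟦<ᵇ⟧+⟦≡ᵇ⟧ {suc x} {suc m} (s≤s x≤m) = ⟦<ᵇ⟧+⟦≡ᵇ⟧ x≤m

<-+-split : ∀ {k b t} → t < k + b → t < k ⊎ Σ ℕ λ i → i < b × t ≡ k + i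
<-+-split {k} {b} {t} t<k+b with t <? k
... | yes t<k = inj₁ t<k
... | no  t≮k = inj₂ (t ∸ k , +-cancelˡ-< k _ _ (subst (_< k + b) (sym k+[t∸k]) t<k+b) , sym k+[t∸k])
  where
  k+[t∸k] : k + (t ∸ k) ≡ t
  k+[t∸k] = m+[n∸m]≡n (≮⇒≥ t≮k)

firstFailure : ∀ {P : ℕ → Set} → U.Decidable P → ∀ n →
               Σ ℕ λ k → k ≤ n × (∀ {j} → j < k → P j) × (k < n → ¬ P k)
firstFailure P? zero = 0 , z≤n , (λ ()) , (λ ())
firstFailure {P} P? (suc n) with firstFailure P? n
... | k , k≤n , holds , fails with m≤n⇒m<n∨m≡n k≤n
...   | inj₁ k<n  = k , m≤n⇒m≤1+n k≤n , holds , (λ _ → fails k<n)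
...   | inj₂ refl with P? k
...     | no ¬Pk = k , n≤1+n k , holds , (λ _ → ¬Pk)
...     | yes Pk = suc k , ≤-refl , holds′ , (λ k<k → ⊥-elim (<-irrefl refl k<k))
  where
  holds′ : ∀ {j} → j < suc k → P j
  holds′ (s≤s j≤k) with m≤n⇒m<n∨m≡n j≤k
  ... | inj₁ j<k  = holds j<k
  ... | inj₂ refl = Pk

-- Sums over ranges of naturals

∑ : ℕ → (ℕ → ℕ) → ℕ
∑ zero    f = 0
∑ (suc n) f = f 0 + ∑ n (f ∘ suc)

syntax ∑ n (λ i → e) = ∑[ i < n ] e

∑-cong : ∀ n {f g : ℕ → ℕ} → (∀ {i} → i < n → f i ≡ g i) → ∑ n f ≡ ∑ n g
∑-cong zero    eq = refl
∑-cong (suc n) eq = cong₂ _+_ (eq z<s) (∑-cong n (eq ∘ s<s))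

∑-split : ∀ m p (f : ℕ → ℕ) → ∑ (m + p) f ≡ ∑ m f + ∑[ i < p ] f (m + i)
∑-split zero    p f = refl
∑-split (suc m) p f = trans (cong (f 0 +_) (∑-split m p (f ∘ suc))) (sym (+-assoc (f 0) _ _))

∑-snoc : ∀ n (f : ℕ → ℕ) → ∑ (suc n) f ≡ ∑ n f + f n
∑-snoc zero    f = +-identityʳ (f 0)
∑-snoc (suc n) f = trans (cong (f 0 +_) (∑-snoc n (f ∘ suc))) (sym (+-assoc (f 0) _ _))

∑-const : ∀ n c → ∑[ _ < n ] c ≡ n * c
∑-const zero    c = refl
∑-const (suc n) c = cong (c +_) (∑-const n c)

∑-zero : ∀ n {f : ℕ → ℕ} → (∀ {i} → i < n → f i ≡ 0) → ∑ n f ≡ 0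
∑-zero n eq = trans (∑-cong n eq) (trans (∑-const n 0) (*-zeroʳ n))

∑-distrib : ∀ n (f g : ℕ → ℕ) → ∑[ i < n ] (f i + g i) ≡ ∑ n f + ∑ n g
∑-distrib zero    f g = refl
∑-distrib (suc n) f g =
  trans (cong (f 0 + g 0 +_) (∑-distrib n (f ∘ suc) (g ∘ suc))) (shuffle (f 0) (g 0) _ _)
  where
  shuffle : ∀ a b c d → a + b + (c + d) ≡ a + c + (b + d)
  shuffle = solve-∀

∑-∸ : ∀ n (f g : ℕ → ℕ) → (∀ {i} → i < n → g i ≤ f i) → ∑[ i < n ] (f i ∸ g i) + ∑ n g ≡ ∑ n f
∑-∸ n f g g≤f = trans (sym (∑-distrib n _ g)) (∑-cong n (m∸n+n≡m ∘ g≤f))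

∑-indicator : ∀ n j → ∑[ i < n ] ⟦ i ≡ᵇ j ⟧ ≡ ⟦ j <ᵇ n ⟧
∑-indicator zero    j       = refl
∑-indicator (suc n) zero    = cong suc (∑-zero n (λ _ → refl))
∑-indicator (suc n) (suc j) = ∑-indicator n j

∑-tail : ∀ {s n} (d : ℕ → ℕ) → s ≤ n → (∀ {j} → s ≤ j → j < n → d j ≡ 1) → ∑ n d ≡ ∑ s d + (n ∸ s)
∑-tail {s} {n} d s≤n ones = begin
  ∑ n d                        ≡⟨ cong (λ m → ∑ m d) (sym s+t≡n) ⟩
  ∑ (s + t) d                  ≡⟨ ∑-split s t d ⟩
  ∑ s d + ∑[ i < t ] d (s + i) ≡⟨ cong (∑ s d +_) (∑-cong t λ i<t → ones (m≤m+n s _) (s+i<n i<t)) ⟩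
  ∑ s d + ∑[ _ < t ] 1         ≡⟨ cong (∑ s d +_) (trans (∑-const t 1) (*-identityʳ t)) ⟩
  ∑ s d + t                    ∎
  where
  open ≡-Reasoning
  t : ℕ
  t = n ∸ s
  s+t≡n : s + t ≡ n
  s+t≡n = m+[n∸m]≡n s≤n
  s+i<n : ∀ {i} → i < t → s + i < n
  s+i<n i<t = subst (_ <_) s+t≡n (+-monoʳ-< s i<t)

-- The handshake lemma

countTrue-suc : ∀ {n} (f : Fin (suc n) → Bool) → countTrue f ≡ ⟦ f Fin.zero ⟧ + countTrue (f ∘ Fin.suc)
countTrue-suc f with f Fin.zero
... | true  = refl
... | false = refl

countTrue-toℕ : ∀ n (h : ℕ → Bool) → countTrue {n} (h ∘ toℕ) ≡ ∑[ i < n ] ⟦ h i ⟧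
countTrue-toℕ zero    h = refl
countTrue-toℕ (suc n) h = trans (countTrue-suc (h ∘ toℕ)) (cong (⟦ h 0 ⟧ +_) (countTrue-toℕ n (h ∘ suc)))

sumFin-toℕ : ∀ n (h : ℕ → ℕ) → sumFin {n} (h ∘ toℕ) ≡ ∑ n h
sumFin-toℕ zero    h = refl
sumFin-toℕ (suc n) h = cong (h 0 +_) (sumFin-toℕ n (h ∘ suc))

countTrue≡sum : ∀ {n} (f : Fin n → Bool) → countTrue f ≡ sum (⟦_⟧ ∘ f)
countTrue≡sum {zero}  f = refl
countTrue≡sum {suc n} f = trans (countTrue-suc f) (cong (⟦ f Fin.zero ⟧ +_) (countTrue≡sum (f ∘ Fin.suc)))

sumFin≡sum : ∀ {n} (f : Fin n → ℕ) → sumFin f ≡ sum f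
sumFin≡sum {zero}  f = refl
sumFin≡sum {suc n} f = cong (f Fin.zero +_) (sumFin≡sum (f ∘ Fin.suc))

countTrue-cong : ∀ {n} {f g : Fin n → Bool} → (∀ v → f v ≡ g v) → countTrue f ≡ countTrue g
countTrue-cong {f = f} {g} f≗g =
  trans (countTrue≡sum f) (trans (sum-cong-≗ (cong ⟦_⟧ ∘ f≗g)) (sym (countTrue≡sum g)))

sumFin-cong : ∀ {n} {f g : Fin n → ℕ} → (∀ v → f v ≡ g v) → sumFin f ≡ sumFin g
sumFin-cong {f = f} {g} f≗g = trans (sumFin≡sum f) (trans (sum-cong-≗ f≗g) (sym (sumFin≡sum g)))

countTrue-pos : ∀ {n} (f : Fin n → Bool) {w} → f w ≡ true → 0 < countTrue f
countTrue-pos {suc n} f {Fin.zero}  fw rewrite countTrue-suc f | fw = z<s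
countTrue-pos {suc n} f {Fin.suc w} fw rewrite countTrue-suc f =
  <-≤-trans (countTrue-pos (f ∘ Fin.suc) fw) (m≤n+m _ ⟦ f Fin.zero ⟧)

forwardAdj : ∀ {n} → SimpleGraph n → Fin n → Fin n → Bool
forwardAdj G u v with u Fin.<? v
... | yes _ = adj G u v
... | no  _ = false

mutual
  numEdges≡ : ∀ {n} (G : SimpleGraph n) → numEdges G ≡ sumFin λ u → countTrue (forwardAdj G u)
  numEdges≡ G = sumFin-cong λ u → countTrue-cong λ v → forwardAdj-unfold G u v

  -- numEdges counts with a copy of forwardAdj local to its definition; this equation identifies the two
  forwardAdj-unfold : ∀ {n} (G : SimpleGraph n) u v → _ ≡ forwardAdj G u v
  forwardAdj-unfold G u v with u Fin.<? v
  ... | yes _ = refl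
  ... | no  _ = refl

module _ {n} (G : SimpleGraph n) where

  forwardAdj-< : ∀ {u v} → u Fin.< v → forwardAdj G u v ≡ adj G u v
  forwardAdj-< {u} {v} u<v with u Fin.<? v
  ... | yes _   = refl
  ... | no  u≮v = ⊥-elim (u≮v u<v)

  forwardAdj-≮ : ∀ {u v} → ¬ u Fin.< v → forwardAdj G u v ≡ false
  forwardAdj-≮ {u} {v} u≮v with u Fin.<? v
  ... | yes u<v = ⊥-elim (u≮v u<v)
  ... | no  _   = refl

  ⟦adj⟧ : ∀ u v → ⟦ adj G u v ⟧ ≡ ⟦ forwardAdj G u v ⟧ + ⟦ forwardAdj G v u ⟧
  ⟦adj⟧ u v with FinP.<-cmp u v
  ... | tri< u<v _ v≮u rewrite forwardAdj-< u<v | forwardAdj-≮ v≮u = sym (+-identityʳ _)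
  ... | tri≈ _ refl _  rewrite forwardAdj-≮ (FinP.<-irrefl {x = u} refl) | irrefl G u = refl
  ... | tri> u≮v _ v<u rewrite forwardAdj-≮ u≮v | forwardAdj-< v<u = cong ⟦_⟧ (SimpleGraph.sym G u v)

  handshake : sumFin (degree G) ≡ numEdges G + numEdges G
  handshake = begin
    sumFin (degree G)                       ≡⟨ sumFin≡sum (degree G) ⟩
    sum (λ u → countTrue (adj G u))         ≡⟨ sum-cong-≗ (countTrue≡sum ∘ adj G) ⟩
    sum (λ u → sum λ v → ⟦ adj G u v ⟧)     ≡⟨ sum-cong-≗ (λ u → sum-cong-≗ (⟦adj⟧ u)) ⟩
    sum (λ u → sum λ v → e u v + e v u)     ≡⟨ sum-cong-≗ (λ u → ∑-distrib-+ (e u) (λ v → e v u)) ⟩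
    sum (λ u → sum (e u) + sum λ v → e v u) ≡⟨ ∑-distrib-+ (sum ∘ e) (λ u → sum λ v → e v u) ⟩
    E + sum (λ u → sum λ v → e v u)         ≡⟨ cong (E +_) (∑-comm (λ u v → e v u)) ⟩
    E + E                                   ≡⟨ sym (cong₂ _+_ numEdges≡E numEdges≡E) ⟩
    numEdges G + numEdges G                 ∎
    where
    open ≡-Reasoning
    e : Fin n → Fin n → ℕ
    e u v = ⟦ forwardAdj G u v ⟧
    E : ℕ
    E = sum λ u → sum (e u)
    numEdges≡E : numEdges G ≡ E
    numEdges≡E = trans (numEdges≡ G)
      (trans (sumFin≡sum (countTrue ∘ forwardAdj G)) (sum-cong-≗ (countTrue≡sum ∘ forwardAdj G)))

connected⇒degree-pos : ∀ {m} {G : SimpleGraph (suc (suc m))} → Connected G → ∀ u → 0 < degree G u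
connected⇒degree-pos {G = G} conn u =
  leaves (conn u (Fin.punchIn u Fin.zero)) (FinP.punchInᵢ≢i u Fin.zero ∘ sym)
  where
  leaves : ∀ {v} → Walk G u v → u ≢ v → 0 < degree G u
  leaves here        u≢u = ⊥-elim (u≢u refl)
  leaves (step uw _) _   = countTrue-pos (adj G u) uw

walk-preserves : ∀ {n} {G : SimpleGraph n} {A : Set} (c : Fin n → A) →
                 (∀ u v → adj G u v ≡ true → c u ≡ c v) → ∀ {u v} → Walk G u v → c u ≡ c v
walk-preserves c pres here           = refl
walk-preserves c pres (step uw walk) = trans (pres _ _ uw) (walk-preserves c pres walk)

-- Degree sequences

-- at D j is the paper's d_{j+1}, with junk value 0 past the end
at : ∀ {n} → Vec ℕ n → ℕ → ℕ
at []      _       = 0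
at (d ∷ D) zero    = d
at (d ∷ D) (suc j) = at D j

at-lookup : ∀ {n} (D : Vec ℕ n) i → at D (toℕ i) ≡ lookup D i
at-lookup (d ∷ D) Fin.zero    = refl
at-lookup (d ∷ D) (Fin.suc i) = at-lookup D i

at-fromℕ< : ∀ {n} (D : Vec ℕ n) {j} (j<n : j < n) → lookup D (fromℕ< j<n) ≡ at D j
at-fromℕ< D j<n = trans (sym (at-lookup D (fromℕ< j<n))) (cong (at D) (FinP.toℕ-fromℕ< j<n))

at-injective : ∀ {n} (D E : Vec ℕ n) → (∀ {j} → j < n → at D j ≡ at E j) → D ≡ E
at-injective []      []      _  = refl
at-injective (d ∷ D) (e ∷ E) eq = cong₂ _∷_ (eq z<s) (at-injective D E (eq ∘ s<s))

at-replicate : ∀ c (a : ℕ) {j} → j < c → at (Vec.replicate c a) j ≡ a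
at-replicate (suc c) a {zero}  _         = refl
at-replicate (suc c) a {suc j} (s≤s j<c) = at-replicate c a j<c

at-replicate-++ : ∀ c (a : ℕ) {m} (R : Vec ℕ m) {j} → j < c → at (Vec.replicate c a Vec.++ R) j ≡ a
at-replicate-++ (suc c) a R {zero}  _         = refl
at-replicate-++ (suc c) a R {suc j} (s≤s j<c) = at-replicate-++ c a R j<c

nonIncreasing-at : ∀ {n} (D : Vec ℕ n) → NonIncreasing D → ∀ {i j} → i ≤ j → j < n → at D j ≤ at D i
nonIncreasing-at D ni {i} {j} i≤j j<n = subst₂ _≤_ (at-fromℕ< D j<n) (at-fromℕ< D i<n)
  (ni (fromℕ< i<n) (fromℕ< j<n) (subst₂ _≤_ (sym (FinP.toℕ-fromℕ< i<n)) (sym (FinP.toℕ-fromℕ< j<n)) i≤j))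
  where
  i<n : i < _
  i<n = ≤-<-trans i≤j j<n

degreeSum : ∀ {n} {D : Vec ℕ n} {G : SimpleGraph n} → Realization D G →
            ∑[ j < n ] at D j ≡ numEdges G + numEdges G
degreeSum {n} {D} {G} R = begin
  ∑[ j < n ] at D j        ≡⟨ sym (sumFin-toℕ n (at D)) ⟩
  sumFin {n} (at D ∘ toℕ) ≡⟨ sumFin-cong (λ i → trans (at-lookup D i) (sym (R i))) ⟩
  sumFin (degree G)       ≡⟨ handshake G ⟩
  numEdges G + numEdges G ∎
  where open ≡-Reasoning

realization-pos : ∀ {n} {D : Vec ℕ n} {G : SimpleGraph n} → Realization D G → Connected G → 2 ≤ n →
                  ∀ {j} → j < n → 1 ≤ at D j
realization-pos {D = D} R conn (s≤s (s≤s _)) j<n =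
  subst (1 ≤_) (trans (R (fromℕ< j<n)) (at-fromℕ< D j<n)) (connected⇒degree-pos conn (fromℕ< j<n))

-- seqA and seqB are the cases ℓ = 0 and ℓ = 1
shape-ℓ+4,2⁶,1ˡ : ∀ {n} (D : Vec ℕ n) ℓ → n ≡ 7 + ℓ → at D 0 ≡ ℓ + 4 → (∀ {j} → j < 6 → at D (suc j) ≡ 2) →
                  (∀ {j} → 7 ≤ j → j < n → at D j ≡ 1) →
                  D ≡seq ((ℓ + 4) ∷ Vec.replicate 6 2 Vec.++ Vec.replicate ℓ 1)
shape-ℓ+4,2⁶,1ˡ D ℓ refl d₀ twos ones = refl , at-injective D _ entry
  where
  entry : ∀ {j} → j < 7 + ℓ → at D j ≡ at ((ℓ + 4) ∷ Vec.replicate 6 2 Vec.++ Vec.replicate ℓ 1) j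
  entry {zero}  _ = d₀
  entry {suc j} (s≤s j<6+ℓ) with <-+-split {6} {ℓ} j<6+ℓ
  ... | inj₁ j<6              = trans (twos j<6) (sym (at-replicate-++ 6 2 (Vec.replicate ℓ 1) j<6))
  ... | inj₂ (i , i<ℓ , refl) = trans (ones (s≤s (m≤m+n 6 i)) (s≤s j<6+ℓ)) (sym (at-replicate ℓ 1 i<ℓ))

-- Graphs presented by back-neighbour lists

infix 4.5 _∈ᵇ_
_∈ᵇ_ : ℕ → List ℕ → Bool
u ∈ᵇ L = does (u ∈? L)

∈ᵇ⇒∈ : ∀ {u L} → u ∈ᵇ L ≡ true → u ∈ L
∈ᵇ⇒∈ {u} {L} eq with u ∈? L
... | yes u∈L = u∈L
∈ᵇ⇒∈ () | no _

⟦∈ᵇ-singleton⟧ : ∀ u p → ⟦ u ∈ᵇ p ∷ [] ⟧ ≡ ⟦ u ≡ᵇ p ⟧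
⟦∈ᵇ-singleton⟧ u p = cong ⟦_⟧ (∨-identityʳ (u ≡ᵇ p))

∑-∈ᵇ : ∀ n {L} → All (_< n) L → Unique L → ∑[ v < n ] ⟦ v ∈ᵇ L ⟧ ≡ length L
∑-∈ᵇ n {[]}    _           _            = ∑-zero n (λ _ → refl)
∑-∈ᵇ n {p ∷ L} (p<n ∷ L<n) (p∉L ∷ uniq) = begin
  ∑[ v < n ] ⟦ v ∈ᵇ p ∷ L ⟧                     ≡⟨ ∑-cong n (λ _ → ⟦∨⟧ p-fresh) ⟩
  ∑[ v < n ] (⟦ v ≡ᵇ p ⟧ + ⟦ v ∈ᵇ L ⟧)          ≡⟨ ∑-distrib n _ _ ⟩
  ∑[ v < n ] ⟦ v ≡ᵇ p ⟧ + ∑[ v < n ] ⟦ v ∈ᵇ L ⟧ ≡⟨ cong₂ _+_ (∑-indicator n p) (∑-∈ᵇ n L<n uniq) ⟩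
  ⟦ p <ᵇ n ⟧ + length L                         ≡⟨ cong (λ b → ⟦ b ⟧ + length L) (dec-true (p <? n) p<n) ⟩
  suc (length L)                                ∎
  where
  open ≡-Reasoning
  p-fresh : ∀ {v} → (v ≡ᵇ p) ≡ true → v ∈ᵇ L ≡ false
  p-fresh v≡p = dec-false (_ ∈? L) λ v∈L → All.lookup p∉L (subst (_∈ L) (≡ᵇ-true⇒≡ v≡p) v∈L) refl

-- F lists, for each vertex t of {0, …, n-1}, its neighbours below t; each edge is listed once.
WellFormed : ℕ → (ℕ → List ℕ) → Set
WellFormed n F = ∀ {t} → t < n → All (_< t) (F t) × Unique (F t)

-- the same for vertices k, …, k+b-1, with the list of vertex k + i stored at index i
WellFormedBlock : ℕ → ℕ → (ℕ → List ℕ) → Set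
WellFormedBlock k b B = ∀ {i} → i < b → All (_< k + i) (B i) × Unique (B i)

inDegree : (ℕ → List ℕ) → ℕ → ℕ → ℕ
inDegree F n u = ∑[ t < n ] ⟦ u ∈ᵇ F t ⟧

record BackLists (n : ℕ) : Set where
  field
    back       : ℕ → List ℕ
    wellFormed : WellFormed n back

  backDegree : ℕ → ℕ
  backDegree u = length (back u) + inDegree back n u

open BackLists

Respects : ℕ → (ℕ → Bool) → (ℕ → List ℕ) → Set
Respects n c F = ∀ {t} → t < n → All (λ p → c p ≡ c t) (F t)

wellFormed? : ∀ n F → Dec (WellFormed n F)
wellFormed? n F = allUpTo? (λ t → All.all? (_<? t) (F t) ×-dec unique? (F t)) n

respects? : ∀ n c F → Dec (Respects n c F)
respects? n c F = allUpTo? (λ t → All.all? (λ p → c p Bool.≟ c t) (F t)) n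

inDegree-∉ : ∀ {F n u} → (∀ {t} → t < n → u ∉ F t) → inDegree F n u ≡ 0
inDegree-∉ {n = n} u∉ = ∑-zero n λ t<n → cong ⟦_⟧ (dec-false (_ ∈? _) (u∉ t<n))

inDegree-≥ : ∀ {n F} → WellFormed n F → ∀ {u} → n ≤ u → inDegree F n u ≡ 0
inDegree-≥ {F = F} wf n≤u = inDegree-∉ {F} λ t<n u∈ →
  <-asym (All.lookup (proj₁ (wf t<n)) u∈) (<-≤-trans t<n n≤u)

module _ {n} (B : BackLists n) where

  private
    F : ℕ → List ℕ
    F = back B
    back-below : ∀ (t : Fin n) → All (_< toℕ t) (F (toℕ t))
    back-below t = proj₁ (wellFormed B (FinP.toℕ<n t))

  toGraph : SimpleGraph n
  toGraph = record
    { adj    = λ u v → (toℕ v ∈ᵇ F (toℕ u)) ∨ (toℕ u ∈ᵇ F (toℕ v))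
    ; sym    = λ u v → ∨-comm (toℕ v ∈ᵇ F (toℕ u)) _
    ; irrefl = λ v → cong (λ b → b ∨ b) (dec-false (_ ∈? _) (λ v∈ → <-irrefl refl (All.lookup (back-below v) v∈)))
    }

  degree-toGraph : ∀ u → degree toGraph u ≡ backDegree B (toℕ u)
  degree-toGraph u = begin
    degree toGraph u                                ≡⟨ countTrue-toℕ n (λ v → (v ∈ᵇ F u′) ∨ (u′ ∈ᵇ F v)) ⟩
    ∑[ v < n ] ⟦ (v ∈ᵇ F u′) ∨ (u′ ∈ᵇ F v) ⟧        ≡⟨ ∑-cong n (λ v<n → ⟦∨⟧ (not-both v<n)) ⟩
    ∑[ v < n ] (⟦ v ∈ᵇ F u′ ⟧ + ⟦ u′ ∈ᵇ F v ⟧)      ≡⟨ ∑-distrib n _ _ ⟩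
    ∑[ v < n ] ⟦ v ∈ᵇ F u′ ⟧ + inDegree F n u′      ≡⟨ cong (_+ inDegree F n u′) (∑-∈ᵇ n F-u<n F-u-unique) ⟩
    backDegree B u′                                 ∎
    where
    open ≡-Reasoning
    u′ : ℕ
    u′ = toℕ u
    u<n : u′ < n
    u<n = FinP.toℕ<n u
    F-u<n : All (_< n) (F u′)
    F-u<n = All.map (λ v<u → <-trans v<u u<n) (back-below u)
    F-u-unique : Unique (F u′)
    F-u-unique = proj₂ (wellFormed B u<n)
    not-both : ∀ {v} → v < n → v ∈ᵇ F u′ ≡ true → u′ ∈ᵇ F v ≡ false
    not-both v<n v∈ = dec-false (_ ∈? _) λ u∈ →
      <-asym (All.lookup (back-below u) (∈ᵇ⇒∈ v∈)) (All.lookup (proj₁ (wellFormed B v<n)) u∈)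

  toGraph-respects : ∀ {c} → Respects n c F → ∀ u v → adj toGraph u v ≡ true → c (toℕ u) ≡ c (toℕ v)
  toGraph-respects resp u v uv with toℕ v ∈ᵇ F (toℕ u) in v∈
  ... | true  = sym (All.lookup (resp (FinP.toℕ<n u)) (∈ᵇ⇒∈ v∈))
  ... | false = All.lookup (resp (FinP.toℕ<n v)) (∈ᵇ⇒∈ uv)

  respects⇒¬connected : ∀ {c} → Respects n c F → ∀ {p q} → p < n → q < n → c p ≢ c q → ¬ Connected toGraph
  respects⇒¬connected {c} resp p<n q<n cp≢cq conn =
    cp≢cq (subst₂ (λ a b → c a ≡ c b) (FinP.toℕ-fromℕ< p<n) (FinP.toℕ-fromℕ< q<n)
      (walk-preserves (c ∘ toℕ) (toGraph-respects resp) (conn (fromℕ< p<n) (fromℕ< q<n))))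

extend : ∀ {A : Set} → ℕ → (ℕ → A) → (ℕ → A) → ℕ → A
extend k f g t = if t <ᵇ k then f t else g (t ∸ k)

module _ {A : Set} (k : ℕ) (f g : ℕ → A) where

  extend-< : ∀ {t} → t < k → extend k f g t ≡ f t
  extend-< {t} t<k rewrite dec-true (t <? k) t<k = refl

  extend-+ : ∀ i → extend k f g (k + i) ≡ g i
  extend-+ i rewrite dec-false (k + i <? k) (≤⇒≯ (m≤m+n k i)) | m+n∸m≡n k i = refl

module _ (k b : ℕ) (F B : ℕ → List ℕ) where

  inDegree-extend : ∀ u → inDegree (extend k F B) (k + b) u ≡ inDegree F k u + inDegree B b u
  inDegree-extend u = trans (∑-split k b _) (cong₂ _+_
    (∑-cong k λ t<k → cong (λ L → ⟦ u ∈ᵇ L ⟧) (extend-< k F B t<k))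
    (∑-cong b λ {i} _ → cong (λ L → ⟦ u ∈ᵇ L ⟧) (extend-+ k F B i)))

  extend-wellFormed : WellFormed k F → WellFormedBlock k b B → WellFormed (k + b) (extend k F B)
  extend-wellFormed wfF wfB t<k+b with <-+-split t<k+b
  ... | inj₁ t<k              = subst (λ L → All (_< _) L × Unique L) (sym (extend-< k F B t<k)) (wfF t<k)
  ... | inj₂ (i , i<b , refl) = subst (λ L → All (_< _) L × Unique L) (sym (extend-+ k F B i)) (wfB i<b)

  extend-respects : ∀ {c} → Respects k c F → (∀ {i} → i < b → All (λ p → c p ≡ c (k + i)) (B i)) →
                    Respects (k + b) c (extend k F B)
  extend-respects respF respB t<k+b with <-+-split t<k+b
  ... | inj₁ t<k              = subst (All _) (sym (extend-< k F B t<k)) (respF t<k)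
  ... | inj₂ (i , i<b , refl) = subst (All _) (sym (extend-+ k F B i)) (respB i<b)

extendBy : ∀ {k} (S : BackLists k) {b} (B : ℕ → List ℕ) → WellFormedBlock k b B → BackLists (k + b)
extendBy {k} S {b} B wfB = record
  { back       = extend k (back S) B
  ; wellFormed = extend-wellFormed k b (back S) B (wellFormed S) wfB
  }

module _ {k} (S : BackLists k) {b} {B : ℕ → List ℕ} (wfB : WellFormedBlock k b B) where

  backDegree-extendBy-< : ∀ {j} → j < k → backDegree (extendBy S B wfB) j ≡ backDegree S j + inDegree B b j
  backDegree-extendBy-< {j} j<k = begin
    length (extend k (back S) B j) + inDegree (extend k (back S) B) (k + b) j
      ≡⟨ cong₂ _+_ (cong length (extend-< k (back S) B j<k)) (inDegree-extend k b (back S) B j) ⟩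
    length (back S j) + (inDegree (back S) k j + inDegree B b j)
      ≡⟨ sym (+-assoc (length (back S j)) _ _) ⟩
    backDegree S j + inDegree B b j
      ∎
    where open ≡-Reasoning

  backDegree-extendBy-+ : ∀ i → backDegree (extendBy S B wfB) (k + i) ≡ length (B i) + inDegree B b (k + i)
  backDegree-extendBy-+ i = begin
    length (extend k (back S) B (k + i)) + inDegree (extend k (back S) B) (k + b) (k + i)
      ≡⟨ cong₂ _+_ (cong length (extend-+ k (back S) B i)) (inDegree-extend k b (back S) B (k + i)) ⟩
    length (B i) + (inDegree (back S) k (k + i) + inDegree B b (k + i))
      ≡⟨ cong (λ z → length (B i) + (z + inDegree B b (k + i))) (inDegree-≥ (wellFormed S) (m≤m+n k i)) ⟩
    length (B i) + inDegree B b (k + i)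
      ∎
    where open ≡-Reasoning

-- Attaching a cycle

-- vertices k, k+1, …, k+m+1 in cyclic order: each lists its predecessor, the last also lists k
cycleBlock : ℕ → ℕ → ℕ → List ℕ
cycleBlock k m zero    = []
cycleBlock k m (suc i) = (k + i) ∷ (if i ≡ᵇ m then k ∷ [] else [])

module _ (k m : ℕ) where

  cycleBlock-inner : ∀ {i} → i ≢ m → cycleBlock k m (suc i) ≡ (k + i) ∷ []
  cycleBlock-inner {i} i≢m rewrite dec-false (i ≟ m) i≢m = refl

  cycleBlock-last : cycleBlock k m (suc m) ≡ (k + m) ∷ k ∷ []
  cycleBlock-last rewrite dec-true (m ≟ m) refl = refl

  cycleBlock-wf : 1 ≤ m → WellFormedBlock k (2 + m) (cycleBlock k m)
  cycleBlock-wf _   {zero}  _ = [] , []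
  cycleBlock-wf 1≤m {suc i} _ with i ≟ m
  ... | yes refl rewrite cycleBlock-last = (+-monoʳ-< k (n<1+n i) ∷ m<m+n k z<s ∷ []) , ((k+m≢k ∷ []) ∷ [] ∷ [])
    where
    k+m≢k : k + m ≢ k
    k+m≢k e = <-irrefl (sym e) (m<m+n k 1≤m)
  ... | no  i≢m  rewrite cycleBlock-inner i≢m = (+-monoʳ-< k (n<1+n i) ∷ []) , ([] ∷ [])

  cycleBlock-≥ : ∀ i → All (k ≤_) (cycleBlock k m i)
  cycleBlock-≥ zero = []
  cycleBlock-≥ (suc i) with i ≟ m
  ... | yes refl rewrite cycleBlock-last      = m≤m+n k i ∷ ≤-refl ∷ []
  ... | no  i≢m  rewrite cycleBlock-inner i≢m = m≤m+n k i ∷ []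

  inDegree-cycle-< : ∀ {u} → u < k → inDegree (cycleBlock k m) (2 + m) u ≡ 0
  inDegree-cycle-< u<k = inDegree-∉ {cycleBlock k m} {2 + m} λ {t} _ u∈ → <⇒≱ u<k (All.lookup (cycleBlock-≥ t) u∈)

  inDegree-cycle : ∀ j → inDegree (cycleBlock k m) (2 + m) (k + j) ≡ ⟦ j <ᵇ m ⟧ + ⟦ (j ≡ᵇ m) ∨ (j ≡ᵇ 0) ⟧
  inDegree-cycle j = begin
    ∑[ i < suc m ] ⟦ k + j ∈ᵇ cycleBlock k m (suc i) ⟧
      ≡⟨ ∑-snoc m _ ⟩
    ∑[ i < m ] ⟦ k + j ∈ᵇ cycleBlock k m (suc i) ⟧ + ⟦ k + j ∈ᵇ cycleBlock k m (suc m) ⟧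
      ≡⟨ cong₂ _+_ (trans (∑-cong m path) (∑-indicator m j)) closing ⟩
    ⟦ j <ᵇ m ⟧ + ⟦ (j ≡ᵇ m) ∨ (j ≡ᵇ 0) ⟧
      ∎
    where
    open ≡-Reasoning
    path : ∀ {i} → i < m → ⟦ k + j ∈ᵇ cycleBlock k m (suc i) ⟧ ≡ ⟦ i ≡ᵇ j ⟧
    path {i} i<m = begin
      ⟦ k + j ∈ᵇ cycleBlock k m (suc i) ⟧ ≡⟨ cong (λ L → ⟦ k + j ∈ᵇ L ⟧) (cycleBlock-inner (<⇒≢ i<m)) ⟩
      ⟦ k + j ∈ᵇ (k + i) ∷ [] ⟧           ≡⟨ ⟦∈ᵇ-singleton⟧ (k + j) (k + i) ⟩
      ⟦ k + j ≡ᵇ k + i ⟧                  ≡⟨ cong ⟦_⟧ (trans (+-≡ᵇ k j i) (≡ᵇ-comm j i)) ⟩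
      ⟦ i ≡ᵇ j ⟧                          ∎
    closing : ⟦ k + j ∈ᵇ cycleBlock k m (suc m) ⟧ ≡ ⟦ (j ≡ᵇ m) ∨ (j ≡ᵇ 0) ⟧
    closing = begin
      ⟦ k + j ∈ᵇ cycleBlock k m (suc m) ⟧           ≡⟨ cong (λ L → ⟦ k + j ∈ᵇ L ⟧) cycleBlock-last ⟩
      ⟦ (k + j ≡ᵇ k + m) ∨ ((k + j ≡ᵇ k) ∨ false) ⟧ ≡⟨ cong ⟦_⟧ (cong₂ _∨_ (+-≡ᵇ k j m) k+j≡ᵇk) ⟩
      ⟦ (j ≡ᵇ m) ∨ (j ≡ᵇ 0) ⟧                       ∎
      where
      k+j≡ᵇk : (k + j ≡ᵇ k) ∨ false ≡ (j ≡ᵇ 0)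
      k+j≡ᵇk = trans (∨-identityʳ _) (trans (cong (k + j ≡ᵇ_) (sym (+-identityʳ k))) (+-≡ᵇ k j 0))

  cycleBlock-degree : 1 ≤ m → ∀ {j} → j < 2 + m →
                      length (cycleBlock k m j) + inDegree (cycleBlock k m) (2 + m) (k + j) ≡ 2
  cycleBlock-degree 1≤m {j} j<2+m rewrite inDegree-cycle j = count j j<2+m
    where
    count : ∀ j → j < 2 + m → length (cycleBlock k m j) + (⟦ j <ᵇ m ⟧ + ⟦ (j ≡ᵇ m) ∨ (j ≡ᵇ 0) ⟧) ≡ 2
    count zero _ rewrite dec-true (0 <? m) 1≤m | ∨-zeroʳ (0 ≡ᵇ m) = refl
    count (suc i) (s≤s (s≤s i≤m)) with i ≟ m
    ... | yes refl rewrite dec-true (m ≟ m) refl | dec-false (suc m <? m) (≤⇒≯ (n≤1+n m))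
                         | dec-false (suc m ≟ m) 1+n≢n = refl
    ... | no  i≢m  rewrite dec-false (i ≟ m) i≢m | ∨-identityʳ (suc i ≡ᵇ m) =
      cong suc (⟦<ᵇ⟧+⟦≡ᵇ⟧ (≤∧≢⇒< i≤m i≢m))

withCycle : ∀ {g} → BackLists g → ∀ m → 1 ≤ m → BackLists (g + (2 + m))
withCycle {g} S m 1≤m = extendBy S (cycleBlock g m) (cycleBlock-wf g m 1≤m)

module _ {g} (S : BackLists g) {m} (1≤m : 1 ≤ m) where

  private
    C : BackLists (g + (2 + m))
    C = withCycle S m 1≤m
    wfB : WellFormedBlock g (2 + m) (cycleBlock g m)
    wfB = cycleBlock-wf g m 1≤m

  backDegree-withCycle-< : ∀ {j} → j < g → backDegree C j ≡ backDegree S j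
  backDegree-withCycle-< {j} j<g = trans (backDegree-extendBy-< S {2 + m} {cycleBlock g m} wfB j<g)
    (trans (cong (backDegree S j +_) (inDegree-cycle-< g m {j} j<g)) (+-identityʳ _))

  backDegree-withCycle-+ : ∀ {i} → i < 2 + m → backDegree C (g + i) ≡ 2
  backDegree-withCycle-+ {i} i<2+m =
    trans (backDegree-extendBy-+ S {2 + m} {cycleBlock g m} wfB i) (cycleBlock-degree g m 1≤m i<2+m)

  ∑-backDegree-withCycle : ∑ (g + (2 + m)) (backDegree C) ≡ ∑ g (backDegree S) + (2 + m) * 2
  ∑-backDegree-withCycle = trans (∑-split g (2 + m) _) (cong₂ _+_
    (∑-cong g backDegree-withCycle-<)
    (trans (∑-cong (2 + m) backDegree-withCycle-+) (∑-const (2 + m) 2)))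

  withCycle-respects : Respects (g + (2 + m)) (_<ᵇ g) (back C)
  withCycle-respects = extend-respects g (2 + m) (back S) (cycleBlock g m) core cycle
    where
    core : Respects g (_<ᵇ g) (back S)
    core t<g = All.map (λ p<t → trans (dec-true (_ <? g) (<-trans p<t t<g)) (sym (dec-true (_ <? g) t<g)))
                       (proj₁ (wellFormed S t<g))
    cycle : ∀ {i} → i < 2 + m → All (λ p → (p <ᵇ g) ≡ (g + i <ᵇ g)) (cycleBlock g m i)
    cycle {i} _ = All.map (λ g≤p → trans (≥-false g≤p) (sym (≥-false (m≤m+n g i)))) (cycleBlock-≥ g m i)
      where
      ≥-false : ∀ {p} → g ≤ p → (p <ᵇ g) ≡ false
      ≥-false g≤p = dec-false (_ <? g) (≤⇒≯ g≤p)

-- Attaching pendant vertices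

multiplicity : ℕ → List ℕ → ℕ
multiplicity u []       = 0
multiplicity u (p ∷ ps) = ⟦ u ≡ᵇ p ⟧ + multiplicity u ps

multiplicity-++ : ∀ u ps qs → multiplicity u (ps ++ qs) ≡ multiplicity u ps + multiplicity u qs
multiplicity-++ u []       qs = refl
multiplicity-++ u (p ∷ ps) qs = trans (cong (⟦ u ≡ᵇ p ⟧ +_) (multiplicity-++ u ps qs)) (sym (+-assoc ⟦ u ≡ᵇ p ⟧ _ _))

multiplicity-replicate : ∀ u c p → multiplicity u (replicate c p) ≡ c * ⟦ u ≡ᵇ p ⟧
multiplicity-replicate u zero    p = refl
multiplicity-replicate u (suc c) p = cong (⟦ u ≡ᵇ p ⟧ +_) (multiplicity-replicate u c p)

-- the attachment points of the pendant vertices: each j < k, repeated x j times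
parents : (ℕ → ℕ) → ℕ → List ℕ
parents x zero    = []
parents x (suc k) = parents x k ++ replicate (x k) k

module _ (x : ℕ → ℕ) where

  length-parents : ∀ k → length (parents x k) ≡ ∑ k x
  length-parents zero    = refl
  length-parents (suc k) = begin
    length (parents x k ++ replicate (x k) k)         ≡⟨ length-++ (parents x k) ⟩
    length (parents x k) + length (replicate (x k) k) ≡⟨ cong₂ _+_ (length-parents k) (length-replicate (x k)) ⟩
    ∑ k x + x k                                       ≡⟨ sym (∑-snoc k x) ⟩
    ∑ (suc k) x                                       ∎
    where open ≡-Reasoning

  parents-< : ∀ k → All (_< k) (parents x k)
  parents-< zero    = []
  parents-< (suc k) = All.++⁺ (All.map (λ p<k → <-trans p<k (n<1+n k)) (parents-< k)) (All.replicate⁺ (x k) (n<1+n k))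

  multiplicity-parents-≥ : ∀ {k u} → k ≤ u → multiplicity u (parents x k) ≡ 0
  multiplicity-parents-≥ {zero}      _   = refl
  multiplicity-parents-≥ {suc k} {u} k<u
    rewrite multiplicity-++ u (parents x k) (replicate (x k) k) | multiplicity-parents-≥ {k} (<⇒≤ k<u)
          | multiplicity-replicate u (x k) k | dec-false (u ≟ k) (>⇒≢ k<u) = *-zeroʳ (x k)

  multiplicity-parents-< : ∀ {k u} → u < k → multiplicity u (parents x k) ≡ x u
  multiplicity-parents-< {suc k} {u} (s≤s u≤k)
    rewrite multiplicity-++ u (parents x k) (replicate (x k) k) | multiplicity-replicate u (x k) k
    with m≤n⇒m<n∨m≡n u≤k
  ... | inj₂ refl rewrite dec-true (u ≟ u) refl | multiplicity-parents-≥ {u} ≤-refl = *-identityʳ (x u)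
  ... | inj₁ u<k  rewrite dec-false (u ≟ k) (<⇒≢ u<k) | multiplicity-parents-< u<k | *-zeroʳ (x k) = +-identityʳ (x u)

-- junk value 0 past the end of the list, where it is never consulted
parent : List ℕ → ℕ → ℕ
parent []       _       = 0
parent (p ∷ ps) zero    = p
parent (p ∷ ps) (suc i) = parent ps i

parent-< : ∀ {k ps i} → All (_< k) ps → i < length ps → parent ps i < k
parent-< {i = zero}  (p<k ∷ _)  _         = p<k
parent-< {i = suc i} (_ ∷ ps<k) (s≤s i<n) = parent-< ps<k i<n

leafBlock : List ℕ → ℕ → List ℕ
leafBlock ps i = parent ps i ∷ []

inDegree-leafBlock : ∀ ps u → inDegree (leafBlock ps) (length ps) u ≡ multiplicity u ps
inDegree-leafBlock []       u = refl
inDegree-leafBlock (p ∷ ps) u = cong₂ _+_ (⟦∈ᵇ-singleton⟧ u p) (inDegree-leafBlock ps u)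

module _ {k} (S : BackLists k) (x : ℕ → ℕ) where

  private
    ps : List ℕ
    ps = parents x k
    ℓ : ℕ
    ℓ = ∑ k x
    parent<k : ∀ {i} → i < ℓ → parent ps i < k
    parent<k {i} i<ℓ = parent-< (parents-< x k) (subst (i <_) (sym (length-parents x k)) i<ℓ)
    wfB : WellFormedBlock k ℓ (leafBlock ps)
    wfB {i} i<ℓ = (<-≤-trans (parent<k i<ℓ) (m≤m+n k i) ∷ []) , ([] ∷ [])
    inDegree-leaves : ∀ u → inDegree (leafBlock ps) ℓ u ≡ multiplicity u ps
    inDegree-leaves u = trans (cong (λ b → inDegree (leafBlock ps) b u) (sym (length-parents x k))) (inDegree-leafBlock ps u)

  withLeaves : BackLists (k + ℓ)
  withLeaves = extendBy S (leafBlock ps) wfB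

  backDegree-withLeaves-< : ∀ {j} → j < k → backDegree withLeaves j ≡ backDegree S j + x j
  backDegree-withLeaves-< {j} j<k = trans (backDegree-extendBy-< S wfB j<k)
    (cong (backDegree S j +_) (trans (inDegree-leaves j) (multiplicity-parents-< x j<k)))

  backDegree-withLeaves-+ : ∀ i → backDegree withLeaves (k + i) ≡ 1
  backDegree-withLeaves-+ i = trans (backDegree-extendBy-+ S wfB i)
    (cong suc (trans (inDegree-leaves (k + i)) (multiplicity-parents-≥ x (m≤m+n k i))))

  withLeaves-respects : ∀ {c} → Respects k c (back S) → Respects (k + ℓ) (extend k c (c ∘ parent ps)) (back withLeaves)
  withLeaves-respects {c} resp = extend-respects k ℓ (back S) (leafBlock ps) core leaf
    where
    c′ : ℕ → Bool
    c′ = extend k c (c ∘ parent ps)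
    c′≡c : ∀ {t} → t < k → c′ t ≡ c t
    c′≡c = extend-< k c (c ∘ parent ps)
    core : Respects k c′ (back S)
    core t<k = All.map (λ (p<t , cp≡ct) → trans (c′≡c (<-trans p<t t<k)) (trans cp≡ct (sym (c′≡c t<k))))
                       (All.zip (proj₁ (wellFormed S t<k) , resp t<k))
    leaf : ∀ {i} → i < ℓ → All (λ p → c′ p ≡ c′ (k + i)) (leafBlock ps i)
    leaf {i} i<ℓ = trans (c′≡c (parent<k i<ℓ)) (sym (extend-+ k c (c ∘ parent ps) i)) ∷ []

-- Refuting forcible bicyclicity

-- the number of pendant vertices needed to raise b to d is the number of 1-entries of d
leafCount : ∀ {s n} (d b : ℕ → ℕ) → s ≤ n → (∀ {j} → j < s → b j ≤ d j) →
            (∀ {j} → s ≤ j → j < n → d j ≡ 1) → ∑ n d ≡ suc n + suc n → ∑ s b ≡ 2 + (s + s) →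
            s + ∑[ j < s ] (d j ∸ b j) ≡ n
leafCount {s} {n} d b s≤n b≤d ones d-sum b-sum = trans (cong (s +_) X≡t) (m+[n∸m]≡n s≤n)
  where
  open ≡-Reasoning
  t X : ℕ
  t = n ∸ s
  X = ∑[ j < s ] (d j ∸ b j)
  total : X + (2 + (s + s)) + t ≡ suc (s + t) + suc (s + t)
  total = begin
    X + (2 + (s + s)) + t     ≡⟨ cong (λ y → X + y + t) (sym b-sum) ⟩
    X + ∑ s b + t             ≡⟨ cong (_+ t) (∑-∸ s d b b≤d) ⟩
    ∑ s d + t                 ≡⟨ sym (∑-tail d s≤n ones) ⟩
    ∑ n d                     ≡⟨ trans d-sum (cong (λ m → suc m + suc m) (sym (m+[n∸m]≡n s≤n))) ⟩
    suc (s + t) + suc (s + t) ∎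
  X≡t : X ≡ t
  X≡t = +-cancelˡ-≡ (2 + (s + s) + t) X t (trans (lhs X s t) (trans total (rhs s t)))
    where
    lhs : ∀ X s t → 2 + (s + s) + t + X ≡ X + (2 + (s + s)) + t
    lhs = solve-∀
    rhs : ∀ s t → suc (s + t) + suc (s + t) ≡ 2 + (s + s) + t + t
    rhs = solve-∀

-- K₄ minus an edge: degrees 3, 3, 2, 2
diamond : BackLists 4
diamond = record { back = F ; wellFormed = from-yes (wellFormed? 4 F) }
  where
  F : ℕ → List ℕ
  F 1 = 0 ∷ []
  F 2 = 0 ∷ 1 ∷ []
  F 3 = 0 ∷ 1 ∷ []
  F _ = []

-- two triangles sharing vertex 0: degrees 4, 2, 2, 2, 2
bowtie : BackLists 5
bowtie = record { back = F ; wellFormed = from-yes (wellFormed? 5 F) }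
  where
  F : ℕ → List ℕ
  F 1 = 0 ∷ []
  F 2 = 0 ∷ 1 ∷ []
  F 3 = 0 ∷ []
  F 4 = 0 ∷ 3 ∷ []
  F _ = []

-- three triangles sharing vertex 0, and the edge 7–8: degrees 6, 2⁶, 1, 1
windmill+edge : BackLists 9
windmill+edge = record { back = F ; wellFormed = from-yes (wellFormed? 9 F) }
  where
  F : ℕ → List ℕ
  F 1 = 0 ∷ []
  F 2 = 0 ∷ 1 ∷ []
  F 3 = 0 ∷ []
  F 4 = 0 ∷ 3 ∷ []
  F 5 = 0 ∷ []
  F 6 = 0 ∷ 5 ∷ []
  F 8 = 7 ∷ []
  F _ = []

windmill+edge-respects : Respects 9 (_<ᵇ 7) (back windmill+edge)
windmill+edge-respects = from-yes (respects? 9 (_<ᵇ 7) (back windmill+edge))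

module _ {n} {D : Vec ℕ n} (fb : ForciblyBicyclic D) where

  private
    d : ℕ → ℕ
    d = at D

  degreeSum-fb : ∑ n d ≡ suc n + suc n
  degreeSum-fb = let (G , R) = proj₁ fb in trans (degreeSum {D = D} R) (cong (λ e → e + e) (proj₂ (proj₂ fb G R)))

  realization-connected : ∀ {N} (H : SimpleGraph N) → N ≡ n → (∀ i → degree H i ≡ d (toℕ i)) → Connected H
  realization-connected H refl deg = proj₁ (proj₂ fb H λ i → trans (deg i) (at-lookup D i))

  refute-with : ∀ {s} (S : BackLists s) {c} → Respects s c (back S) → ∀ {p q} → p < s → q < s → c p ≢ c q →
                s ≤ n → (∀ {j} → j < s → backDegree S j ≤ d j) → (∀ {j} → s ≤ j → j < n → d j ≡ 1) →
                ∑ s (backDegree S) ≡ 2 + (s + s) → ⊥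
  refute-with {s} S {c} resp p<s q<s cp≢cq s≤n S≤d ones S-sum =
    respects⇒¬connected L (withLeaves-respects S x resp) (widen p<s) (widen q<s)
      (λ e → cp≢cq (trans (sym (same-colour p<s)) (trans e (same-colour q<s))))
      (realization-connected (toGraph L) size realizes)
    where
    x : ℕ → ℕ
    x j = d j ∸ backDegree S j
    L : BackLists (s + ∑ s x)
    L = withLeaves S x
    size : s + ∑ s x ≡ n
    size = leafCount d (backDegree S) s≤n S≤d ones degreeSum-fb S-sum
    widen : ∀ {j} → j < s → j < s + ∑ s x
    widen j<s = <-≤-trans j<s (m≤m+n s _)
    same-colour : ∀ {j} → j < s → extend s c (c ∘ parent (parents x s)) j ≡ c j
    same-colour = extend-< s c (c ∘ parent (parents x s))
    realizes : ∀ i → degree (toGraph L) i ≡ d (toℕ i)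
    realizes i with <-+-split (FinP.toℕ<n i)
    ... | inj₁ j<s = trans (degree-toGraph L i) (trans (backDegree-withLeaves-< S x j<s) (m+[n∸m]≡n (S≤d j<s)))
    ... | inj₂ (l , l<ℓ , e) = trans (degree-toGraph L i) (trans (cong (backDegree L) e)
          (trans (backDegree-withLeaves-+ S x l) (trans (sym d≡1) (cong d (sym e)))))
      where
      d≡1 : d (s + l) ≡ 1
      d≡1 = ones (m≤m+n s l) (subst (s + l <_) size (+-monoʳ-< s l<ℓ))

  record Profile (k : ℕ) : Set where
    field
      k≤n : k ≤ n
      ≥2  : ∀ {j} → j < k → 2 ≤ d j
      ≡1  : ∀ {j} → k ≤ j → j < n → d j ≡ 1

  open Profile

  refute-withCycle : ∀ {g} (G : BackLists g) → 1 ≤ g → ∑ g (backDegree G) ≡ 2 + (g + g) →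
                     ∀ m → Profile (g + (2 + suc m)) → (∀ {j} → j < g → backDegree G j ≤ d j) → ⊥
  refute-withCycle {g} G 1≤g G-sum m prof G≤d =
    refute-with C (withCycle-respects G 1≤m) {0} {g} (<-≤-trans 1≤g (m≤m+n g _)) (m<m+n g z<s) colours-differ
      (k≤n prof) C≤d (≡1 prof) C-sum
    where
    1≤m : 1 ≤ suc m
    1≤m = s≤s z≤n
    C : BackLists (g + (2 + suc m))
    C = withCycle G (suc m) 1≤m
    colours-differ : (0 <ᵇ g) ≢ (g <ᵇ g)
    colours-differ rewrite dec-true (0 <? g) 1≤g | dec-false (g <? g) (<-irrefl refl) = λ ()
    C≤d : ∀ {j} → j < g + (2 + suc m) → backDegree C j ≤ d j
    C≤d {j} j<K with <-+-split j<K
    ... | inj₁ j<g                = subst (_≤ d j) (sym (backDegree-withCycle-< G 1≤m j<g)) (G≤d j<g)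
    ... | inj₂ (i , i<2+m , refl) = subst (_≤ d (g + i)) (sym (backDegree-withCycle-+ G 1≤m i<2+m)) (≥2 prof j<K)
    C-sum : ∑ (g + (2 + suc m)) (backDegree C) ≡ 2 + (g + (2 + suc m) + (g + (2 + suc m)))
    C-sum = trans (∑-backDegree-withCycle G 1≤m) (trans (cong (_+ (2 + suc m) * 2) G-sum) (arith g m))
      where
      arith : ∀ g m → 2 + (g + g) + (2 + suc m) * 2 ≡ 2 + (g + (2 + suc m) + (g + (2 + suc m)))
      arith = solve-∀

  module _ (ni : NonIncreasing D) (7≤n : 7 ≤ n) where

    private
      d-mono : ∀ {i j} → i ≤ j → j < n → d j ≤ d i
      d-mono = nonIncreasing-at D ni

      d-pos : ∀ {j} → j < n → 1 ≤ d j
      d-pos = let (G , R) = proj₁ fb in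
        realization-pos {D = D} R (proj₁ (proj₂ fb G R)) (≤-trans (s≤s (s≤s z≤n)) 7≤n)

      ≥2-at : ∀ {k} → Profile k → ∀ j → {j<k : True (j <? k)} → 2 ≤ d j
      ≥2-at prof j {j<k} = ≥2 prof (toWitness j<k)

    profile : Σ ℕ Profile
    profile with firstFailure (λ j → 2 ≤? d j) n
    ... | k , k≤n , holds , fails = k , record { k≤n = k≤n ; ≥2 = holds ; ≡1 = ones }
      where
      ones : ∀ {j} → k ≤ j → j < n → d j ≡ 1
      ones k≤j j<n = ≤-antisym (≤-trans (d-mono k≤j j<n) (s≤s⁻¹ (≰⇒> (fails (≤-<-trans k≤j j<n))))) (d-pos j<n)

    d₀-value : ∀ {k} → Profile (suc k) → (∀ {j} → j < k → d (suc j) ≡ 2) → d 0 ≡ (n ∸ suc k) + 4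
    d₀-value {k} prof twos = +-cancelˡ-≡ (k * 2 + ℓ) (d 0) (ℓ + 4) (begin
      k * 2 + ℓ + d 0                   ≡⟨ +-comm (k * 2 + ℓ) (d 0) ⟩
      d 0 + (k * 2 + ℓ)                 ≡⟨ sym (+-assoc (d 0) _ ℓ) ⟩
      d 0 + k * 2 + ℓ                   ≡⟨ cong (λ z → d 0 + z + ℓ) (sym (trans (∑-cong k twos) (∑-const k 2))) ⟩
      ∑ (suc k) d + ℓ                   ≡⟨ sym (∑-tail d (k≤n prof) (≡1 prof)) ⟩
      ∑ n d                             ≡⟨ degreeSum-fb ⟩
      suc n + suc n                     ≡⟨ cong (λ m → suc m + suc m) (sym (m+[n∸m]≡n (k≤n prof))) ⟩
      suc (suc k + ℓ) + suc (suc k + ℓ) ≡⟨ arith k ℓ ⟩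
      k * 2 + ℓ + (ℓ + 4)               ∎)
      where
      open ≡-Reasoning
      ℓ = n ∸ suc k
      arith : ∀ k ℓ → suc (suc k + ℓ) + suc (suc k + ℓ) ≡ k * 2 + ℓ + (ℓ + 4)
      arith = solve-∀

    refute-diamond : ∀ m → Profile (7 + m) → 3 ≤ d 1 → ⊥
    refute-diamond m prof 3≤d₁ = refute-withCycle diamond (s≤s z≤n) refl m prof ≤d
      where
      ≤d : ∀ {j} → j < 4 → backDegree diamond j ≤ d j
      ≤d {0} _ = ≤-trans 3≤d₁ (d-mono z≤n (≤-trans (s≤s (s≤s z≤n)) 7≤n))
      ≤d {1} _ = 3≤d₁
      ≤d {2} _ = ≥2-at prof 2
      ≤d {3} _ = ≥2-at prof 3
      ≤d {suc (suc (suc (suc _)))} (s≤s (s≤s (s≤s (s≤s ()))))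

    refute-bowtie : ∀ m → Profile (8 + m) → 4 ≤ d 0 → ⊥
    refute-bowtie m prof 4≤d₀ = refute-withCycle bowtie (s≤s z≤n) refl m prof ≤d
      where
      ≤d : ∀ {j} → j < 5 → backDegree bowtie j ≤ d j
      ≤d {0} _ = 4≤d₀
      ≤d {1} _ = ≥2-at prof 1
      ≤d {2} _ = ≥2-at prof 2
      ≤d {3} _ = ≥2-at prof 3
      ≤d {4} _ = ≥2-at prof 4
      ≤d {suc (suc (suc (suc (suc _))))} (s≤s (s≤s (s≤s (s≤s (s≤s ())))))

    refute-windmill+edge : ∀ ℓ → n ≡ 9 + ℓ → Profile 7 → 6 ≤ d 0 → ⊥
    refute-windmill+edge ℓ refl prof 6≤d₀ =
      refute-with windmill+edge windmill+edge-respects {0} {7} z<s (m<m+n 7 z<s) (λ ()) (m≤m+n 9 ℓ)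
        ≤d (λ 9≤j → ≡1 prof (≤-trans (m≤m+n 7 2) 9≤j)) refl
      where
      ≤d : ∀ {j} → j < 9 → backDegree windmill+edge j ≤ d j
      ≤d {0} _ = 6≤d₀
      ≤d {1} _ = ≥2-at prof 1
      ≤d {2} _ = ≥2-at prof 2
      ≤d {3} _ = ≥2-at prof 3
      ≤d {4} _ = ≥2-at prof 4
      ≤d {5} _ = ≥2-at prof 5
      ≤d {6} _ = ≥2-at prof 6
      ≤d {7} _ = ≤-reflexive (sym (≡1 prof ≤-refl (m<m+n 7 z<s)))
      ≤d {8} _ = ≤-reflexive (sym (≡1 prof (n≤1+n 7) (m<m+n 8 z<s)))
      ≤d {suc (suc (suc (suc (suc (suc (suc (suc (suc _))))))))}
         (s≤s (s≤s (s≤s (s≤s (s≤s (s≤s (s≤s (s≤s (s≤s ())))))))))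

    all-twos : ∀ m → Profile (7 + m) → (∀ {j} → j < 6 + m → d (suc j) ≡ 2) →
               ¬ (D ≡seq seqA) → ¬ (D ≡seq seqB) → ⊥
    all-twos (suc m) prof twos _  _  = refute-bowtie m prof (subst (4 ≤_) (sym (d₀-value prof twos)) (m≤n+m 4 _))
    all-twos zero    prof twos nA nB = by-ℓ (n ∸ 7) (sym (m+[n∸m]≡n 7≤n)) (d₀-value prof twos)
      where
      by-ℓ : ∀ ℓ → n ≡ 7 + ℓ → d 0 ≡ ℓ + 4 → ⊥
      by-ℓ 0             n≡7   d₀≡4   = nA (shape-ℓ+4,2⁶,1ˡ D 0 n≡7 d₀≡4 twos (≡1 prof))
      by-ℓ 1             n≡8   d₀≡5   = nB (shape-ℓ+4,2⁶,1ˡ D 1 n≡8 d₀≡5 twos (≡1 prof))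
      by-ℓ (suc (suc ℓ)) n≡9+ℓ d₀≡6+ℓ =
        refute-windmill+edge ℓ n≡9+ℓ prof (subst (6 ≤_) (sym d₀≡6+ℓ) (s≤s (s≤s (m≤n+m 4 ℓ))))

    long-prefix : ∀ m → Profile (7 + m) → ¬ (D ≡seq seqA) → ¬ (D ≡seq seqB) → ⊥
    long-prefix m prof nA nB with 3 ≤? d 1
    ... | yes 3≤d₁ = refute-diamond m prof 3≤d₁
    ... | no  3≰d₁ = all-twos m prof twos nA nB
      where
      twos : ∀ {j} → j < 6 + m → d (suc j) ≡ 2
      twos j<6+m = ≤-antisym (≤-trans (d-mono (s≤s z≤n) (<-≤-trans (s≤s j<6+m) (k≤n prof))) (s≤s⁻¹ (≰⇒> 3≰d₁)))
                             (≥2 prof (s≤s j<6+m))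

    d₆≡1 : ¬ (D ≡seq seqA) → ¬ (D ≡seq seqB) → d 6 ≡ 1
    d₆≡1 nA nB with profile
    ... | k , prof with 7 ≤? k
    ...   | yes (s≤s (s≤s (s≤s (s≤s (s≤s (s≤s (s≤s _))))))) = ⊥-elim (long-prefix _ prof nA nB)
    ...   | no  7≰k = ≡1 prof (s≤s⁻¹ (≰⇒> 7≰k)) 7≤n

lemma4p9 : (n : ℕ) (D : Vec ℕ n) → NonIncreasing D → ForciblyBicyclic D
    → (n≥7 : n ≥ 7) → ¬ (D ≡seq seqA) → ¬ (D ≡seq seqB)
    → lookup D (fromℕ< n≥7) ≡ 1
lemma4p9 n D ni fb n≥7 nA nB = trans (at-fromℕ< D n≥7) (d₆≡1 fb ni n≥7 nA nB)
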